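{- Let $d_1\ge 2$, $d_2\ge 2$. If $A$ is a $d_1$-dimensional permutation of order $n$ (a polystochastic $(0,1)$-matrix) and $B$ is a vertex of $\Omega_n^{d_2}$, then the dot product $A\cdot B$ is a vertex of $\Omega_n^{d_1+d_2-2}$, and $N(A\cdot B)=n^{d_1-2}\cdot N(B)$.
   Context: A $d$-dimensional matrix of order $n$ is an array indexed by $I_n^d=\{(\alpha_1,\dots,\alpha_d):\alpha_i\in\{0,\dots,n-1\}\}$; $N(A)$ is its number of nonzero entries. A line is the set of entries obtained by fixing all but one index position. A nonnegative matrix is polystochastic if each line sums to $1$; $\Omega_n^d$ is the polytope of $d$-dimensional polystochastic matrices of order $n$, and a vertex is an element that is not a nontrivial convex combination of other elements. For a $d_1$-dimensional matrix $A$ and a $d_2$-dimensional matrix $B$, both of order $n$, the dot product $C=A\cdot B$ is the $(d_1+d_2-2)$-dimensional matrix of order $n$ with $c_\gamma=\sum_{i=0}^{n-1}a_{\alpha,i}b_{i,\beta}$, where $\gamma=\alpha\beta$ is the concatenation of $\alpha\in I_n^{d_1-1}$ and $\beta\in I_n^{d_2-1}$.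
   Formalization: The matrices A and B have rational entries, and in the notion of vertex the convex weights and the other polystochastic matrices are taken in the rationals. -}

module Defs where

open import Data.Nat using (ℕ; zero; suc) renaming (_+_ to _+ℕ_)
open import Data.Fin using (Fin; zero; suc)
open import Data.Vec using (Vec; []; _∷_; _[_]≔_; _∷ʳ_; splitAt)
open import Data.Product using (Σ; ∃; _×_; _,_; proj₁; proj₂)
open import Data.Bool using (Bool; true; false; if_then_else_)
open import Data.Rational using (ℚ; 0ℚ; 1ℚ; _+_; _*_; _-_; _<_; _≟_)
open import Relation.Nullary using (¬_; does)
open import Relation.Binary.PropositionalEquality using (_≡_)

Idx : ℕ → ℕ → Set
Idx n d = Vec (Fin n) d

Matrix : ℕ → ℕ → Set
Matrix n d = Idx n d → ℚ

Σℚ : ∀ {n} → (Fin n → ℚ) → ℚ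
Σℚ {zero}  f = 0ℚ
Σℚ {suc n} f = f zero + Σℚ (λ i → f (suc i))

Σℕ : ∀ {n} → (Fin n → ℕ) → ℕ
Σℕ {zero}  f = 0
Σℕ {suc n} f = f zero +ℕ Σℕ (λ i → f (suc i))

count : ∀ {n} d → (Idx n d → Bool) → ℕ
count zero    P = if P [] then 1 else 0
count (suc d) P = Σℕ (λ i → count d (λ v → P (i ∷ v)))

N : ∀ {n d} → Matrix n d → ℕ
N {d = d} A = count d (λ α → if does (A α ≟ 0ℚ) then false else true)

-- Polystochastic: nonnegative, and every line sums to 1.  The line through α
-- in direction p is { α[p] ≔ i : i ∈ Fin n }.
Polystochastic : ∀ {n d} → Matrix n d → Set
Polystochastic {n} {d} A =
  (∀ α → 0ℚ Data.Rational.≤ A α) ×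
  (∀ (p : Fin d) (α : Idx n d) → Σℚ (λ i → A (α [ p ]≔ i)) ≡ 1ℚ)

IsPermutation : ∀ {n d} → Matrix n d → Set
IsPermutation A = Polystochastic A × (∀ α → (A α ≡ 0ℚ) Data.Sum.⊎ (A α ≡ 1ℚ))
  where import Data.Sum

_≋_ : ∀ {n d} → Matrix n d → Matrix n d → Set
A ≋ B = ∀ α → A α ≡ B α

IsVertex : ∀ {n d} → Matrix n d → Set
IsVertex {n} {d} A =
  Polystochastic A ×
  ¬ (Σ (Matrix n d) λ A₁ → Σ (Matrix n d) λ A₂ → Σ ℚ λ t →
       Polystochastic A₁ × Polystochastic A₂ ×
       0ℚ < t × t < 1ℚ ×
       ¬ (A₁ ≋ A) × ¬ (A₂ ≋ A) ×
       (∀ α → A α ≡ t * A₁ α + (1ℚ - t) * A₂ α))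

_·_ : ∀ {n k₁ k₂} → Matrix n (suc k₁) → Matrix n (suc k₂) → Matrix n (k₁ +ℕ k₂)
_·_ {n} {k₁} {k₂} A B γ with splitAt k₁ γ
... | α , β , _ = Σℚ (λ i → A (α ∷ʳ i) * B (i ∷ β))

{-# OPTIONS --safe #-}
module Submission where

-- Since A is a permutation, the row α ∷ʳ · of A contains a single 1, at
-- position σ α, so (A · B) (α ++ β) = B (σ α ∷ β).  The first-direction lines
-- of A also contain a single 1, so for every α′ the map j ↦ σ (j ∷ α′) is a
-- permutation of Fin n.  Hence, for each α′, the entries (j ∷ α′) ++ β of A · B
-- form a copy of B whose first index is permuted, and every polystochastic
-- matrix restricts to a polystochastic matrix on such a copy.  A convex
-- decomposition of A · B therefore restricts to one of B on every copy, which
-- is trivial when B is a vertex; and counting nonzero entries copy by copy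
-- gives N (A · B) = n ^ (d₁ - 2) · N B.

open import Defs
open import Data.Bool using (Bool; true; false; if_then_else_)
open import Data.Fin using (Fin; zero; suc)
open import Data.Product using (Σ-syntax; ∃-syntax; _×_; _,_; proj₁; proj₂)
open import Data.Vec using (Vec; []; _∷_; _++_)
open import Function using (_∘_)
open import Relation.Binary.PropositionalEquality
  using (_≡_; _≢_; _≗_; refl; sym; trans; cong; subst; subst₂; module ≡-Reasoning)
open ≡-Reasoning

module DotProduct where

  open import Data.Nat as ℕ using (zero; suc)
  open import Data.Fin as Fin using (inject₁; fromℕ; _↑ˡ_; _↑ʳ_; punchIn; join)
  open import Data.Fin.Properties using (punchInᵢ≢i; join-splitAt) renaming (_≟_ to _≟ᶠ_)
  open import Data.Fin.Permutation
    using (Permutation; permutation; flip; _⟨$⟩ˡ_; inverseˡ; inverseʳ)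
  open import Data.Vec using (_∷ʳ_; _[_]≔_; splitAt; head; lookup)
  open import Data.Vec.Properties using ([]≔-++-↑ˡ; []≔-++-↑ʳ)
  open import Data.Sum using (_⊎_; inj₁; inj₂; [_,_])
  open import Data.Empty using (⊥-elim)
  open import Relation.Nullary.Decidable using (decidable-stable)
  open import Data.Rational as ℚ using (ℚ; 0ℚ; 1ℚ; _+_; _*_; _-_; _<_; _≤_; _≟_)
  import Data.Rational.Properties as ℚₚ
  open import Algebra.Bundles using (CommutativeRing)
  open import Data.Rational.Solver using (module +-*-Solver)
  open import Algebra.Properties.CommutativeMonoid.Sum ℚₚ.+-0-commutativeMonoid
    using (sum; sum-cong-≗; sum-remove; sum-replicate-zero; ∑-comm; sum-permute)
  open import Algebra.Properties.Semiring.Sum (CommutativeRing.semiring ℚₚ.+-*-commutativeRing)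
    using (*-distribˡ-sum; *-distribʳ-sum)
  open import Algebra.Properties.Group ℚₚ.+-0-group using (identityʳ-unique)

  Σℚ≡sum : ∀ {n} (f : Fin n → ℚ) → Σℚ f ≡ sum f
  Σℚ≡sum {zero}  f = refl
  Σℚ≡sum {suc n} f = cong (f zero +_) (Σℚ≡sum (f ∘ suc))

  sum-nonneg : ∀ {n} {f : Fin n → ℚ} → (∀ i → 0ℚ ≤ f i) → 0ℚ ≤ sum f
  sum-nonneg {zero}  _   = ℚₚ.≤-refl
  sum-nonneg {suc n} f≥0 = ℚₚ.+-mono-≤ (f≥0 zero) (sum-nonneg (f≥0 ∘ suc))

  *-nonneg : ∀ {p q} → 0ℚ ≤ p → 0ℚ ≤ q → 0ℚ ≤ p * q
  *-nonneg {p} {q} 0≤p 0≤q = ℚₚ.nonNegative⁻¹ (p * q)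
    {{ℚₚ.nonNeg*nonNeg⇒nonNeg p {{ℚ.nonNegative 0≤p}} q {{ℚ.nonNegative 0≤q}}}}

  nonneg-+≡0ˡ : ∀ {p q} → 0ℚ ≤ p → 0ℚ ≤ q → p + q ≡ 0ℚ → p ≡ 0ℚ
  nonneg-+≡0ˡ {p} 0≤p 0≤q p+q≡0 = ℚₚ.≤-antisym p≤0 0≤p
    where
    p≤0 : p ≤ 0ℚ
    p≤0 = subst₂ _≤_ (ℚₚ.+-identityʳ p) p+q≡0 (ℚₚ.+-monoʳ-≤ p 0≤q)

  nonneg-sum≡0 : ∀ {n} {f : Fin n → ℚ} → (∀ i → 0ℚ ≤ f i) → sum f ≡ 0ℚ → ∀ i → f i ≡ 0ℚ
  nonneg-sum≡0 {suc n} {f} f≥0 Σf≡0 i =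
    nonneg-+≡0ˡ (f≥0 i) (sum-nonneg (f≥0 ∘ punchIn i)) (trans (sym (sum-remove f)) Σf≡0)

  sum-supported : ∀ {n} {f : Fin n → ℚ} k → (∀ i → i ≢ k → f i ≡ 0ℚ) → sum f ≡ f k
  sum-supported {suc n} {f} k f≡0 = begin
    sum f                              ≡⟨ sum-remove f ⟩
    f k + sum (λ i → f (punchIn k i))  ≡⟨ cong (f k +_) (sum-cong-≗ (λ i → f≡0 _ (punchInᵢ≢i k i))) ⟩
    f k + sum {n} (λ _ → 0ℚ)           ≡⟨ cong (f k +_) (sum-replicate-zero n) ⟩
    f k + 0ℚ                           ≡⟨ ℚₚ.+-identityʳ (f k) ⟩
    f k                                ∎

  IsUnitVector : ∀ {n} → (Fin n → ℚ) → Fin n → Set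
  IsUnitVector w k = w k ≡ 1ℚ × (∀ i → i ≢ k → w i ≡ 0ℚ)

  unit-unique : ∀ {n} {w : Fin n → ℚ} {k i} → IsUnitVector w k → w i ≡ 1ℚ → i ≡ k
  unit-unique {k = k} {i} (_ , others≡0) wi≡1 =
    decidable-stable (i ≟ᶠ k) (λ i≢k → 1≢0 (trans (sym wi≡1) (others≡0 i i≢k)))
    where
    1≢0 : 1ℚ ≢ 0ℚ
    1≢0 ()

  zero-one-sum≡1⇒unit : ∀ {n} {w : Fin n → ℚ} → (∀ i → w i ≡ 0ℚ ⊎ w i ≡ 1ℚ) →
                        sum w ≡ 1ℚ → ∃[ k ] IsUnitVector w k
  zero-one-sum≡1⇒unit {zero} _ ()
  zero-one-sum≡1⇒unit {suc n} {w} w01 Σw≡1 with w01 zero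
  ... | inj₂ w₀≡1 = zero , w₀≡1 , λ where
      zero    0≢0 → ⊥-elim (0≢0 refl)
      (suc i) _   → nonneg-sum≡0 (zero-one-nonneg ∘ w01 ∘ suc) rest≡0 i
    where
    zero-one-nonneg : ∀ {x} → x ≡ 0ℚ ⊎ x ≡ 1ℚ → 0ℚ ≤ x
    zero-one-nonneg (inj₁ refl) = ℚₚ.≤-refl
    zero-one-nonneg (inj₂ refl) = ℚₚ.nonNegative⁻¹ 1ℚ
    rest≡0 : sum (w ∘ suc) ≡ 0ℚ
    rest≡0 = identityʳ-unique 1ℚ _ (trans (cong (_+ sum (w ∘ suc)) (sym w₀≡1)) Σw≡1)
  ... | inj₁ w₀≡0 = shift (zero-one-sum≡1⇒unit (w01 ∘ suc) rest≡1)
    where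
    rest≡1 : sum (w ∘ suc) ≡ 1ℚ
    rest≡1 = trans (sym (ℚₚ.+-identityˡ _)) (trans (cong (_+ sum (w ∘ suc)) (sym w₀≡0)) Σw≡1)
    shift : ∃[ k ] IsUnitVector (w ∘ suc) k → ∃[ k ] IsUnitVector w k
    shift (k , wk≡1 , others≡0) = suc k , wk≡1 , λ where
      zero    _   → w₀≡0
      (suc i) i≢k → others≡0 i (i≢k ∘ cong suc)

  line-sum : ∀ {n d} {X : Matrix n d} → Polystochastic X → ∀ p α → sum (λ i → X (α [ p ]≔ i)) ≡ 1ℚ
  line-sum {X = X} (_ , lines) p α = trans (sym (Σℚ≡sum (λ i → X (α [ p ]≔ i)))) (lines p α)

  polystochastic : ∀ {n d} {X : Matrix n d} → (∀ α → 0ℚ ≤ X α) →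
                   (∀ p α → sum (λ i → X (α [ p ]≔ i)) ≡ 1ℚ) → Polystochastic X
  polystochastic {X = X} nonneg lines =
    nonneg , λ p α → trans (Σℚ≡sum (λ i → X (α [ p ]≔ i))) (lines p α)

  []≔-∷ʳ-inject₁ : ∀ {A : Set} {m} (α : Vec A m) x p y →
                   (α ∷ʳ x) [ inject₁ p ]≔ y ≡ (α [ p ]≔ y) ∷ʳ x
  []≔-∷ʳ-inject₁ (a ∷ α) x zero    y = refl
  []≔-∷ʳ-inject₁ (a ∷ α) x (suc p) y = cong (a ∷_) ([]≔-∷ʳ-inject₁ α x p y)

  []≔-∷ʳ-fromℕ : ∀ {A : Set} {m} (α : Vec A m) x y → (α ∷ʳ x) [ fromℕ m ]≔ y ≡ α ∷ʳ y
  []≔-∷ʳ-fromℕ []      x y = refl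
  []≔-∷ʳ-fromℕ (a ∷ α) x y = cong (a ∷_) ([]≔-∷ʳ-fromℕ α x y)

  -- The Fin n argument is any point of the line: without it the claim fails for n = 0.
  ∷ʳ-line-sum : ∀ {n m} {X : Matrix n (suc m)} → Polystochastic X → Fin n → ∀ α →
                sum (λ i → X (α ∷ʳ i)) ≡ 1ℚ
  ∷ʳ-line-sum {X = X} X-poly x α =
    trans (sum-cong-≗ (λ i → cong X (sym ([]≔-∷ʳ-fromℕ α x i))))
          (line-sum X-poly (fromℕ _) (α ∷ʳ x))

  ∷-line-sum : ∀ {n m} {X : Matrix n (suc m)} → Polystochastic X → Fin n → ∀ α →
               sum (λ i → X (i ∷ α)) ≡ 1ℚ
  ∷-line-sum X-poly x α = line-sum X-poly zero (x ∷ α)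

  splitAt-++ : ∀ {A : Set} {m l} (α : Vec A m) (β : Vec A l) → splitAt m (α ++ β) ≡ (α , β , refl)
  splitAt-++ []      β = refl
  splitAt-++ (a ∷ α) β rewrite splitAt-++ α β = refl

  ++-elim : ∀ {A : Set} {m l} {P : Vec A (m ℕ.+ l) → Set} → (∀ α β → P (α ++ β)) → ∀ γ → P γ
  ++-elim {m = m} f γ with splitAt m γ
  ... | α , β , refl = f α β

  ↑-elim : ∀ {m l} {P : Fin (m ℕ.+ l) → Set} → (∀ i → P (i ↑ˡ l)) → (∀ j → P (m ↑ʳ j)) → ∀ p → P p
  ↑-elim {m} {l} {P} left right p =
    subst P (join-splitAt m l p) ([_,_] {C = P ∘ join m l} left right (Fin.splitAt m p))

  ·-++ : ∀ {n k₁ k₂} (A : Matrix n (suc k₁)) (B : Matrix n (suc k₂)) (α : Idx n k₁) (β : Idx n k₂) →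
         (A · B) (α ++ β) ≡ sum (λ i → A (α ∷ʳ i) * B (i ∷ β))
  ·-++ A B α β rewrite splitAt-++ α β = Σℚ≡sum (λ i → A (α ∷ʳ i) * B (i ∷ β))

  ·-polystochastic : ∀ {n k₁ k₂} {A : Matrix n (suc k₁)} {B : Matrix n (suc k₂)} →
                     Polystochastic A → Polystochastic B → Polystochastic (A · B)
  ·-polystochastic {k₁ = k₁} {k₂} {A} {B} A-poly B-poly =
    polystochastic (++-elim {m = k₁} nonneg) lines
    where
    nonneg : ∀ α β → 0ℚ ≤ (A · B) (α ++ β)
    nonneg α β = subst (0ℚ ≤_) (sym (·-++ A B α β))
      (sum-nonneg (λ i → *-nonneg (proj₁ A-poly (α ∷ʳ i)) (proj₁ B-poly (i ∷ β))))

    left-line : ∀ p α β → sum (λ x → (A · B) ((α ++ β) [ p ↑ˡ k₂ ]≔ x)) ≡ 1ℚ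
    left-line p α β = begin
      sum (λ x → (A · B) ((α ++ β) [ p ↑ˡ k₂ ]≔ x))
        ≡⟨ sum-cong-≗ (λ x → trans (cong (A · B) ([]≔-++-↑ˡ {x = x} α β p)) (·-++ A B _ β)) ⟩
      sum (λ x → sum (λ i → A ((α [ p ]≔ x) ∷ʳ i) * B (i ∷ β)))
        ≡⟨ ∑-comm (λ x i → A ((α [ p ]≔ x) ∷ʳ i) * B (i ∷ β)) ⟩
      sum (λ i → sum (λ x → A ((α [ p ]≔ x) ∷ʳ i) * B (i ∷ β)))
        ≡⟨ sum-cong-≗ (λ i → *-distribʳ-sum (B (i ∷ β)) (λ x → A ((α [ p ]≔ x) ∷ʳ i))) ⟨
      sum (λ i → sum (λ x → A ((α [ p ]≔ x) ∷ʳ i)) * B (i ∷ β))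
        ≡⟨ sum-cong-≗ (λ i → cong (_* B (i ∷ β)) (A-line i)) ⟩
      sum (λ i → 1ℚ * B (i ∷ β))
        ≡⟨ sum-cong-≗ (λ i → ℚₚ.*-identityˡ (B (i ∷ β))) ⟩
      sum (λ i → B (i ∷ β))
        ≡⟨ ∷-line-sum B-poly (lookup α p) β ⟩
      1ℚ ∎
      where
      A-line : ∀ i → sum (λ x → A ((α [ p ]≔ x) ∷ʳ i)) ≡ 1ℚ
      A-line i = trans (sum-cong-≗ (λ x → cong A (sym ([]≔-∷ʳ-inject₁ α i p x))))
                       (line-sum A-poly (inject₁ p) (α ∷ʳ i))

    right-line : ∀ p α β → sum (λ x → (A · B) ((α ++ β) [ k₁ ↑ʳ p ]≔ x)) ≡ 1ℚ
    right-line p α β = begin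
      sum (λ x → (A · B) ((α ++ β) [ k₁ ↑ʳ p ]≔ x))
        ≡⟨ sum-cong-≗ (λ x → trans (cong (A · B) ([]≔-++-↑ʳ {y = x} α β p)) (·-++ A B α _)) ⟩
      sum (λ x → sum (λ i → A (α ∷ʳ i) * B (i ∷ (β [ p ]≔ x))))
        ≡⟨ ∑-comm (λ x i → A (α ∷ʳ i) * B (i ∷ (β [ p ]≔ x))) ⟩
      sum (λ i → sum (λ x → A (α ∷ʳ i) * B (i ∷ (β [ p ]≔ x))))
        ≡⟨ sum-cong-≗ (λ i → *-distribˡ-sum (A (α ∷ʳ i)) (λ x → B (i ∷ (β [ p ]≔ x)))) ⟨
      sum (λ i → A (α ∷ʳ i) * sum (λ x → B ((i ∷ β) [ suc p ]≔ x)))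
        ≡⟨ sum-cong-≗ (λ i → cong (A (α ∷ʳ i) *_) (line-sum B-poly (suc p) (i ∷ β))) ⟩
      sum (λ i → A (α ∷ʳ i) * 1ℚ)
        ≡⟨ sum-cong-≗ (λ i → ℚₚ.*-identityʳ (A (α ∷ʳ i))) ⟩
      sum (λ i → A (α ∷ʳ i))
        ≡⟨ ∷ʳ-line-sum A-poly (lookup β p) α ⟩
      1ℚ ∎

    lines : ∀ p γ → sum (λ x → (A · B) (γ [ p ]≔ x)) ≡ 1ℚ
    lines = ↑-elim {k₁} (λ p → ++-elim {m = k₁} (left-line p)) (λ p → ++-elim (right-line p))

  convex-cancel : ∀ {t a b} → 0ℚ < t → b ≡ t * a + (1ℚ - t) * b → a ≡ b
  convex-cancel {t} {a} {b} 0<t b≡ta+[1-t]b =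
    ℚₚ.≤-antisym (ℚₚ.*-cancelˡ-≤-pos t (ℚₚ.≤-reflexive ta≡tb))
                 (ℚₚ.*-cancelˡ-≤-pos t (ℚₚ.≤-reflexive (sym ta≡tb)))
    where
    open +-*-Solver
    instance
      t-positive : ℚ.Positive t
      t-positive = ℚ.positive 0<t
    ta≡tb : t * a ≡ t * b
    ta≡tb = begin
      t * a
        ≡⟨ solve 3 (λ t a b → t :* a := (t :* a :+ (con 1ℚ :- t) :* b) :+ (t :* b :- b)) refl t a b ⟩
      (t * a + (1ℚ - t) * b) + (t * b - b)
        ≡⟨ cong (_+ (t * b - b)) b≡ta+[1-t]b ⟨
      b + (t * b - b)
        ≡⟨ solve 2 (λ t b → b :+ (t :* b :- b) := t :* b) refl t b ⟩
      t * b ∎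

  -- IsVertex stated positively; the two agree because equality on ℚ is decidable.
  Extremal : ∀ {n d} → Matrix n d → Set
  Extremal {n} {d} X = ∀ (X₁ X₂ : Matrix n d) t → Polystochastic X₁ → Polystochastic X₂ →
                       0ℚ < t → t < 1ℚ → (∀ α → X α ≡ t * X₁ α + (1ℚ - t) * X₂ α) → X₁ ≋ X

  vertex⇒extremal : ∀ {n d} {X : Matrix n d} → IsVertex X → Extremal X
  vertex⇒extremal {X = X} (_ , indecomposable) X₁ X₂ t X₁-poly X₂-poly 0<t t<1 split α =
    decidable-stable (X₁ α ≟ X α) λ X₁α≢Xα →
      indecomposable (X₁ , X₂ , t , X₁-poly , X₂-poly , 0<t , t<1 ,
                      (λ X₁≋X → X₁α≢Xα (X₁≋X α)) , (λ X₂≋X → X₁α≢Xα (X₁α≡Xα X₂≋X)) , split)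
    where
    X₁α≡Xα : X₂ ≋ X → X₁ α ≡ X α
    X₁α≡Xα X₂≋X = convex-cancel 0<t (trans (split α) (cong (λ y → t * X₁ α + (1ℚ - t) * y) (X₂≋X α)))

  extremal⇒vertex : ∀ {n d} {X : Matrix n d} → Polystochastic X → Extremal X → IsVertex X
  extremal⇒vertex X-poly X-extremal =
    X-poly , λ (X₁ , X₂ , t , X₁-poly , X₂-poly , 0<t , t<1 , X₁≉X , _ , split) →
      X₁≉X (X-extremal X₁ X₂ t X₁-poly X₂-poly 0<t t<1 split)

  PreservesPolystochastic : ∀ {n d e} → (Idx n e → Idx n d) → Set
  PreservesPolystochastic {n} {d} s = ∀ {X : Matrix n d} → Polystochastic X → Polystochastic (X ∘ s)

  CopyThrough : ∀ {n d e} → Matrix n d → Matrix n e → Idx n d → Set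
  CopyThrough {n} {d} {e} C B γ =
    Σ[ s ∈ (Idx n e → Idx n d) ] PreservesPolystochastic s × (C ∘ s) ≋ B × ∃[ v ] s v ≡ γ

  extremal-from-copies : ∀ {n d e} {C : Matrix n d} {B : Matrix n e} →
                         Extremal B → (∀ γ → CopyThrough C B γ) → Extremal C
  extremal-from-copies {C = C} {B} B-extremal copies C₁ C₂ t C₁-poly C₂-poly 0<t t<1 split γ
    with copies γ
  ... | s , s-preserves , C∘s≋B , v , refl = begin
    C₁ (s v)  ≡⟨ B-extremal (C₁ ∘ s) (C₂ ∘ s) t (s-preserves C₁-poly) (s-preserves C₂-poly)
                               0<t t<1 split-B v ⟩
    B v       ≡⟨ C∘s≋B v ⟨
    C (s v)   ∎
    where
    split-B : ∀ w → B w ≡ t * C₁ (s w) + (1ℚ - t) * C₂ (s w)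
    split-B w = trans (sym (C∘s≋B w)) (split (s w))

  module DotByPermutation {n k} {A : Matrix n (suc (suc k))} (A-perm : IsPermutation A) where

    private
      A-poly = proj₁ A-perm
      A-01 = proj₂ A-perm

    row-unit : ∀ α → ∃[ i ] IsUnitVector (λ i → A (α ∷ʳ i)) i
    row-unit α = zero-one-sum≡1⇒unit (λ i → A-01 (α ∷ʳ i)) (∷ʳ-line-sum A-poly (head α) α)

    σ : Idx n (suc k) → Fin n
    σ α = proj₁ (row-unit α)

    column-unit : ∀ α′ i → ∃[ j ] IsUnitVector (λ j → A ((j ∷ α′) ∷ʳ i)) j
    column-unit α′ i =
      zero-one-sum≡1⇒unit (λ j → A-01 ((j ∷ α′) ∷ʳ i)) (∷-line-sum A-poly i (α′ ∷ʳ i))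

    σ-permutation : Idx n k → Permutation n n
    σ-permutation α′ = permutation (λ j → σ (j ∷ α′)) column-one σ∘column-one column-one∘σ
      where
      column-one : Fin n → Fin n
      column-one i = proj₁ (column-unit α′ i)
      σ∘column-one : ∀ i → σ (column-one i ∷ α′) ≡ i
      σ∘column-one i = sym (unit-unique (proj₂ (row-unit _)) (proj₁ (proj₂ (column-unit α′ i))))
      column-one∘σ : ∀ j → column-one (σ (j ∷ α′)) ≡ j
      column-one∘σ j =
        sym (unit-unique (proj₂ (column-unit α′ _)) (proj₁ (proj₂ (row-unit (j ∷ α′)))))

    ·-entry : ∀ {k₂} (B : Matrix n (suc k₂)) α β → (A · B) (α ++ β) ≡ B (σ α ∷ β)
    ·-entry B α β = begin
      (A · B) (α ++ β)                    ≡⟨ ·-++ A B α β ⟩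
      sum (λ i → A (α ∷ʳ i) * B (i ∷ β))  ≡⟨ sum-supported (σ α) off-σ ⟩
      A (α ∷ʳ σ α) * B (σ α ∷ β)          ≡⟨ cong (_* B (σ α ∷ β)) (proj₁ (proj₂ (row-unit α))) ⟩
      1ℚ * B (σ α ∷ β)                    ≡⟨ ℚₚ.*-identityˡ (B (σ α ∷ β)) ⟩
      B (σ α ∷ β)                         ∎
      where
      off-σ : ∀ i → i ≢ σ α → A (α ∷ʳ i) * B (i ∷ β) ≡ 0ℚ
      off-σ i i≢σα = trans (cong (_* B (i ∷ β)) (proj₂ (proj₂ (row-unit α)) i i≢σα))
                           (ℚₚ.*-zeroˡ (B (i ∷ β)))

    copy : ∀ {k₂} → Idx n k → Idx n (suc k₂) → Idx n (suc k ℕ.+ k₂)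
    copy α′ (i ∷ β) = ((σ-permutation α′ ⟨$⟩ˡ i) ∷ α′) ++ β

    copy-preserves : ∀ {k₂} α′ → PreservesPolystochastic (copy {k₂} α′)
    copy-preserves α′ {X} X-poly =
      polystochastic (λ { (i ∷ β) → proj₁ X-poly (copy α′ (i ∷ β)) }) lines
      where
      lines : ∀ p v → sum (λ x → X (copy α′ (v [ p ]≔ x))) ≡ 1ℚ
      lines zero (i ∷ β) = begin
        sum (λ x → X (((σ-permutation α′ ⟨$⟩ˡ x) ∷ α′) ++ β))
          ≡⟨ sum-permute (λ j → X ((j ∷ α′) ++ β)) (flip (σ-permutation α′)) ⟨
        sum (λ j → X ((j ∷ α′) ++ β))
          ≡⟨ line-sum X-poly zero ((i ∷ α′) ++ β) ⟩
        1ℚ ∎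
      lines (suc p) (i ∷ β) =
        trans (sum-cong-≗ (λ x → cong X (sym ([]≔-++-↑ʳ {y = x} (_ ∷ α′) β p))))
              (line-sum X-poly (suc k ↑ʳ p) (copy α′ (i ∷ β)))

    ·-extremal : ∀ {k₂} {B : Matrix n (suc k₂)} → Extremal B → Extremal (A · B)
    ·-extremal {k₂} {B} B-extremal =
      extremal-from-copies B-extremal (++-elim {m = suc k} copy-through)
      where
      copy-through : ∀ α β → CopyThrough (A · B) B (α ++ β)
      copy-through (j ∷ α′) β =
        copy α′ , copy-preserves α′ , copy-is-B , σ (j ∷ α′) ∷ β ,
        cong (λ j′ → (j′ ∷ α′) ++ β) (inverseˡ (σ-permutation α′))
        where
        copy-is-B : ((A · B) ∘ copy α′) ≋ B
        copy-is-B (i ∷ β′) =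
          trans (·-entry B _ β′) (cong (λ i′ → B (i′ ∷ β′)) (inverseʳ (σ-permutation α′)))

open DotProduct using (·-polystochastic; vertex⇒extremal; extremal⇒vertex; module DotByPermutation)

open import Data.Nat using (ℕ; zero; suc; _+_; _≤_; _^_; _*_; _∸_; s≤s; z≤n)
open import Data.Nat.Properties using (*-assoc; +-identityʳ; +-0-commutativeMonoid)
open import Data.Rational using (ℚ; 0ℚ; _≟_)
open import Relation.Nullary using (does)
open import Algebra.Properties.CommutativeMonoid.Sum +-0-commutativeMonoid
  using (sum; sum-cong-≗; ∑-comm; sum-permute)

∑ᴵ : ∀ {n} d → (Idx n d → ℕ) → ℕ
∑ᴵ zero    f = f []
∑ᴵ (suc d) f = sum (λ i → ∑ᴵ d (λ α → f (i ∷ α)))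

Σℕ≡sum : ∀ {n} (f : Fin n → ℕ) → Σℕ f ≡ sum f
Σℕ≡sum {zero}  f = refl
Σℕ≡sum {suc n} f = cong (f zero +_) (Σℕ≡sum (f ∘ suc))

sum-const : ∀ {n} c → sum {n} (λ _ → c) ≡ n * c
sum-const {zero}  c = refl
sum-const {suc n} c = cong (c +_) (sum-const {n} c)

count≡∑ᴵ : ∀ {n} d (P : Idx n d → Bool) → count d P ≡ ∑ᴵ d (λ α → if P α then 1 else 0)
count≡∑ᴵ zero    P = refl
count≡∑ᴵ (suc d) P = trans (Σℕ≡sum (λ i → count d (λ α → P (i ∷ α))))
                           (sum-cong-≗ (λ i → count≡∑ᴵ d (λ α → P (i ∷ α))))

∑ᴵ-cong : ∀ {n} d {f g : Idx n d → ℕ} → f ≗ g → ∑ᴵ d f ≡ ∑ᴵ d g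
∑ᴵ-cong zero    f≗g = f≗g []
∑ᴵ-cong (suc d) f≗g = sum-cong-≗ (λ i → ∑ᴵ-cong d (λ α → f≗g (i ∷ α)))

∑ᴵ-++ : ∀ {n} d e (f : Idx n (d + e) → ℕ) → ∑ᴵ (d + e) f ≡ ∑ᴵ d (λ α → ∑ᴵ e (λ β → f (α ++ β)))
∑ᴵ-++ zero    e f = refl
∑ᴵ-++ (suc d) e f = sum-cong-≗ (λ i → ∑ᴵ-++ d e (λ γ → f (i ∷ γ)))

∑ᴵ-sum-comm : ∀ {n m} d (g : Fin m → Idx n d → ℕ) →
              ∑ᴵ d (λ α → sum (λ j → g j α)) ≡ sum (λ j → ∑ᴵ d (g j))
∑ᴵ-sum-comm zero    g = refl
∑ᴵ-sum-comm (suc d) g = trans (sum-cong-≗ (λ i → ∑ᴵ-sum-comm d (λ j α → g j (i ∷ α))))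
                              (∑-comm (λ i j → ∑ᴵ d (λ α → g j (i ∷ α))))

∑ᴵ-const : ∀ {n} d c → ∑ᴵ {n} d (λ _ → c) ≡ n ^ d * c
∑ᴵ-const zero    c = sym (+-identityʳ c)
∑ᴵ-const {n} (suc d) c = begin
  ∑ᴵ {n} (suc d) (λ _ → c)    ≡⟨ sum-cong-≗ {n} (λ _ → ∑ᴵ-const d c) ⟩
  sum {n} (λ _ → n ^ d * c)   ≡⟨ sum-const {n} (n ^ d * c) ⟩
  n * (n ^ d * c)             ≡⟨ *-assoc n (n ^ d) c ⟨
  n ^ suc d * c               ∎

module _ {n k k₂} {A : Matrix n (suc (suc k))} (A-perm : IsPermutation A)
         (B : Matrix n (suc k₂)) where

  open DotByPermutation A-perm

  ∑ᴵ-· : ∀ (w : ℚ → ℕ) → ∑ᴵ (suc k + k₂) (w ∘ (A · B)) ≡ n ^ k * ∑ᴵ (suc k₂) (w ∘ B)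
  ∑ᴵ-· w = begin
    ∑ᴵ (suc k + k₂) (w ∘ (A · B))
      ≡⟨ ∑ᴵ-++ (suc k) k₂ (w ∘ (A · B)) ⟩
    ∑ᴵ (suc k) (λ α → ∑ᴵ k₂ (λ β → w ((A · B) (α ++ β))))
      ≡⟨ ∑ᴵ-cong (suc k) (λ α → ∑ᴵ-cong k₂ (λ β → cong w (·-entry B α β))) ⟩
    ∑ᴵ (suc k) (λ α → h (σ α))
      ≡⟨ ∑ᴵ-sum-comm k (λ j α′ → h (σ (j ∷ α′))) ⟨
    ∑ᴵ k (λ α′ → sum (λ j → h (σ (j ∷ α′))))
      ≡⟨ ∑ᴵ-cong k (λ α′ → sum-permute h (σ-permutation α′)) ⟨
    ∑ᴵ k (λ _ → sum h)
      ≡⟨ ∑ᴵ-const k (sum h) ⟩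
    n ^ k * sum h ∎
    where
    h : Fin n → ℕ
    h i = ∑ᴵ k₂ (λ β → w (B (i ∷ β)))

  N-· : N (A · B) ≡ n ^ k * N B
  N-· = begin
    N (A · B)                       ≡⟨ count≡∑ᴵ (suc k + k₂) (nonzero? ∘ (A · B)) ⟩
    ∑ᴵ (suc k + k₂) (w ∘ (A · B))   ≡⟨ ∑ᴵ-· w ⟩
    n ^ k * ∑ᴵ (suc k₂) (w ∘ B)     ≡⟨ cong (n ^ k *_) (count≡∑ᴵ (suc k₂) (nonzero? ∘ B)) ⟨
    n ^ k * N B                     ∎
    where
    nonzero? : ℚ → Bool
    nonzero? x = if does (x ≟ 0ℚ) then false else true
    w : ℚ → ℕ
    w x = if nonzero? x then 1 else 0

theorem2 : ∀ (n k₁ k₂ : ℕ) → 1 ≤ k₁ → 1 ≤ k₂ →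
    (A : Matrix n (suc k₁)) (B : Matrix n (suc k₂)) →
    IsPermutation A → IsVertex B →
    IsVertex (A · B) × (N (A · B) ≡ n ^ (k₁ ∸ 1) * N B)
theorem2 n (suc k) k₂ (s≤s z≤n) _ A B A-perm B-vertex =
  extremal⇒vertex (·-polystochastic (proj₁ A-perm) (proj₁ B-vertex))
                  (·-extremal (vertex⇒extremal B-vertex)) ,
  N-· A-perm B
  where open DotByPermutation A-perm
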